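{- Let $\mathbf{A}$ be a finitely subdirectly irreducible De Morgan monoid, and let $a\in A$ with $f\leqslant a$ and $a\not< f^2$. Then $a$ is idempotent, i.e., $a^2=a$.
   Context: An involutive (commutative) residuated lattice (IRL) is an algebra $\langle A;\cdot,\wedge,\vee,\neg,e\rangle$ such that $\langle A;\cdot,e\rangle$ is a commutative monoid, $\langle A;\wedge,\vee\rangle$ is a lattice with order $\leqslant$, $\neg\neg x=x$, and $x\cdot y\leqslant z\iff \neg z\cdot y\leqslant\neg x$. Write $f:=\neg e$, $x^2:=x\cdot x$. A De Morgan monoid is an IRL with distributive lattice reduct satisfying $x\leqslant x^2$. An algebra is finitely subdirectly irreducible if its identity relation is meet-irreducible in its congruence lattice. -}

module Defs where

open import Level using (Level; suc; _⊔_)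
open import Relation.Binary.PropositionalEquality using (_≡_)
open import Relation.Binary.Core using (Rel)
open import Relation.Binary.Structures using (IsEquivalence)
open import Relation.Nullary using (¬_)
open import Data.Product using (_×_)
open import Data.Sum using (_⊎_)
open import Data.Unit using (⊤)
open import Level using (Lift)

record DMSignature (a : Level) : Set (suc a) where
  field
    Carrier : Set a
    _·_ : Carrier → Carrier → Carrier
    _∧_ : Carrier → Carrier → Carrier
    _∨_ : Carrier → Carrier → Carrier
    ∼_  : Carrier → Carrier
    e   : Carrier

  infixl 7 _·_
  infixr 6 _∧_
  infixr 5 _∨_
  infix 8 ∼_
  infix 4 _≤_ _<_

  _≤_ : Carrier → Carrier → Set a
  x ≤ y = (x ∧ y) ≡ x

  _<_ : Carrier → Carrier → Set a
  x < y = (x ≤ y) × ¬ (x ≡ y)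

  f : Carrier
  f = ∼ e

  _² : Carrier → Carrier
  x ² = x · x

record IsDeMorganMonoid {a : Level} (A : DMSignature a) : Set a where
  open DMSignature A
  field
    ·-assoc : ∀ x y z → ((x · y) · z) ≡ (x · (y · z))
    ·-comm  : ∀ x y → (x · y) ≡ (y · x)
    ·-identityˡ : ∀ x → (e · x) ≡ x
    ∧-assoc : ∀ x y z → ((x ∧ y) ∧ z) ≡ (x ∧ (y ∧ z))
    ∨-assoc : ∀ x y z → ((x ∨ y) ∨ z) ≡ (x ∨ (y ∨ z))
    ∧-comm  : ∀ x y → (x ∧ y) ≡ (y ∧ x)
    ∨-comm  : ∀ x y → (x ∨ y) ≡ (y ∨ x)
    ∧-absorbs-∨ : ∀ x y → (x ∧ (x ∨ y)) ≡ x
    ∨-absorbs-∧ : ∀ x y → (x ∨ (x ∧ y)) ≡ x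
    ∧-distribˡ-∨ : ∀ x y z → (x ∧ (y ∨ z)) ≡ ((x ∧ y) ∨ (x ∧ z))
    ∼-involutive : ∀ x → (∼ ∼ x) ≡ x
    residuation⇒ : ∀ x y z → x · y ≤ z → ∼ z · y ≤ ∼ x
    residuation⇐ : ∀ x y z → ∼ z · y ≤ ∼ x → x · y ≤ z
    square-increasing : ∀ x → x ≤ x ²

record IsCongruence {a : Level} (A : DMSignature a) (θ : Rel (DMSignature.Carrier A) a) : Set a where
  open DMSignature A
  field
    isEquivalence : IsEquivalence θ
    ·-cong : ∀ {x x′ y y′} → θ x x′ → θ y y′ → θ (x · y) (x′ · y′)
    ∧-cong : ∀ {x x′ y y′} → θ x x′ → θ y y′ → θ (x ∧ y) (x′ ∧ y′)
    ∨-cong : ∀ {x x′ y y′} → θ x x′ → θ y y′ → θ (x ∨ y) (x′ ∨ y′)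
    ∼-cong : ∀ {x x′} → θ x x′ → θ (∼ x) (∼ x′)

IsIdentityRel : {a : Level} {X : Set a} → Rel X a → Set a
IsIdentityRel {X = X} θ = ∀ (x y : X) → θ x y → x ≡ y

-- Finitely subdirectly irreducible: the identity congruence is
-- meet-irreducible in the congruence lattice, i.e. whenever the meet
-- (intersection) of two congruences is the identity, one of them is.
-- (Meet-irreducibility of the bottom element of a lattice means exactly
-- this, since id ≤ θ, φ always.)  Meet-irreducible elements are by
-- convention distinct from the top, so A is nontrivial (identity ≠ total).
FSI : {a : Level} (A : DMSignature a) → Set (suc a)
FSI {a} A = (¬ IsIdentityRel {X = DMSignature.Carrier A} (λ _ _ → Lift a ⊤))
  × (∀ (θ φ : Rel (DMSignature.Carrier A) a)
  → IsCongruence A θ → IsCongruence A φ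
  → IsIdentityRel (λ x y → θ x y × φ x y)
  → IsIdentityRel θ ⊎ IsIdentityRel φ)

module Submission where

open import Defs
open import Relation.Binary.PropositionalEquality using (_≡_)
open import Relation.Nullary using (¬_)
open import Level using (Level)

open import Relation.Binary.PropositionalEquality using (refl; sym; trans; cong; cong₂; subst; subst₂; isEquivalence)
open import Relation.Nullary using (Dec; yes; no)
open import Relation.Binary.Core using (Rel)
open import Relation.Binary.Bundles using (Poset)
open import Data.Product using (_×_; _,_)
open import Data.Sum using (_⊎_; inj₁; inj₂)
open import Data.Empty using (⊥-elim)
open import Algebra.Bundles using (CommutativeSemigroup)
open import Algebra.Lattice.Bundles using (Lattice)
import Algebra.Properties.CommutativeSemigroup as CommutativeSemigroupProperties
import Algebra.Lattice.Properties.Lattice as LatticeProperties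
import Relation.Binary.Lattice as OrderTheoretic
import Relation.Binary.Reasoning.PartialOrder as PartialOrderReasoning

-- The proof combines three facts.
--  * In every De Morgan monoid, f² ≤ a implies a² = a: the element ∼a lies
--    below ∼(f²) ≤ e, hence is idempotent, and a residuation argument gives
--    a² · ∼a ≤ f, i.e. a² ≤ a.  In particular f² is idempotent.
--  * In an FSI De Morgan monoid, e ≤ x or x ≤ f for every x.  For d ≤ e the
--    relation θ_d (x · d ≤ y and y · d ≤ x) is a congruence; θ_{e ∧ x} and
--    θ_{e ∧ ∼x} meet in the identity, so one of them is the identity.
--  * Equality in an FSI algebra is decidable: the congruence generated by
--    (u , v) and the congruence "everything is identified if u = v" meet in
--    the identity.
-- Applying the dichotomy to a · ∼(f²) gives a² = a or a ≤ f²; in the second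
-- case decidability of a = f² and the hypothesis a ≮ f² force a = f².

module FSI-DecidableEquality {ℓ : Level} (A : DMSignature ℓ) where
  open DMSignature A

  data Generated (u v : Carrier) : Rel Carrier ℓ where
    gen-base  : Generated u v u v
    gen-refl  : ∀ {x} → Generated u v x x
    gen-sym   : ∀ {x y} → Generated u v x y → Generated u v y x
    gen-trans : ∀ {x y z} → Generated u v x y → Generated u v y z → Generated u v x z
    gen-·     : ∀ {x x′ y y′} → Generated u v x x′ → Generated u v y y′ → Generated u v (x · y) (x′ · y′)
    gen-∧     : ∀ {x x′ y y′} → Generated u v x x′ → Generated u v y y′ → Generated u v (x ∧ y) (x′ ∧ y′)
    gen-∨     : ∀ {x x′ y y′} → Generated u v x x′ → Generated u v y y′ → Generated u v (x ∨ y) (x′ ∨ y′)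
    gen-∼     : ∀ {x x′} → Generated u v x x′ → Generated u v (∼ x) (∼ x′)

  Generated-isCongruence : ∀ u v → IsCongruence A (Generated u v)
  Generated-isCongruence u v = record
    { isEquivalence = record { refl = gen-refl ; sym = gen-sym ; trans = gen-trans }
    ; ·-cong = gen-· ; ∧-cong = gen-∧ ; ∨-cong = gen-∨ ; ∼-cong = gen-∼ }

  Generated-trivial : ∀ {u v x y} → u ≡ v → Generated u v x y → x ≡ y
  Generated-trivial u≡v gen-base          = u≡v
  Generated-trivial u≡v gen-refl          = refl
  Generated-trivial u≡v (gen-sym p)       = sym (Generated-trivial u≡v p)
  Generated-trivial u≡v (gen-trans p q)   = trans (Generated-trivial u≡v p) (Generated-trivial u≡v q)
  Generated-trivial u≡v (gen-· p q)       = cong₂ _·_ (Generated-trivial u≡v p) (Generated-trivial u≡v q)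
  Generated-trivial u≡v (gen-∧ p q)       = cong₂ _∧_ (Generated-trivial u≡v p) (Generated-trivial u≡v q)
  Generated-trivial u≡v (gen-∨ p q)       = cong₂ _∨_ (Generated-trivial u≡v p) (Generated-trivial u≡v q)
  Generated-trivial u≡v (gen-∼ p)         = cong ∼_ (Generated-trivial u≡v p)

  TotalIf : Set ℓ → Rel Carrier ℓ
  TotalIf P x y = x ≡ y ⊎ P

  TotalIf-isCongruence : ∀ P → IsCongruence A (TotalIf P)
  TotalIf-isCongruence P = record
    { isEquivalence = record { refl = inj₁ refl ; sym = symmetric ; trans = transitive }
    ; ·-cong = compatible₂ _·_ ; ∧-cong = compatible₂ _∧_ ; ∨-cong = compatible₂ _∨_
    ; ∼-cong = compatible₁ }
    where
      symmetric : ∀ {x y} → TotalIf P x y → TotalIf P y x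
      symmetric (inj₁ x≡y) = inj₁ (sym x≡y)
      symmetric (inj₂ p)   = inj₂ p

      transitive : ∀ {x y z} → TotalIf P x y → TotalIf P y z → TotalIf P x z
      transitive (inj₁ x≡y) (inj₁ y≡z) = inj₁ (trans x≡y y≡z)
      transitive (inj₁ _)   (inj₂ p)   = inj₂ p
      transitive (inj₂ p)   _          = inj₂ p

      compatible₂ : (_∘_ : Carrier → Carrier → Carrier) → ∀ {x x′ y y′}
                  → TotalIf P x x′ → TotalIf P y y′ → TotalIf P (x ∘ y) (x′ ∘ y′)
      compatible₂ _∘_ (inj₁ x≡x′) (inj₁ y≡y′) = inj₁ (cong₂ _∘_ x≡x′ y≡y′)
      compatible₂ _∘_ (inj₁ _)    (inj₂ p)    = inj₂ p
      compatible₂ _∘_ (inj₂ p)    _           = inj₂ p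

      compatible₁ : ∀ {x x′} → TotalIf P x x′ → TotalIf P (∼ x) (∼ x′)
      compatible₁ (inj₁ x≡x′) = inj₁ (cong ∼_ x≡x′)
      compatible₁ (inj₂ p)    = inj₂ p

  -- Equality in an FSI algebra is decidable: if Generated u v is the identity
  -- then u = v; if TotalIf (u ≡ v) is the identity then u = v would make the
  -- algebra trivial.
  FSI⇒≡-decidable : FSI A → ∀ u v → Dec (u ≡ v)
  FSI⇒≡-decidable (nontrivial , irreducible) u v
    with irreducible (Generated u v) (TotalIf (u ≡ v))
           (Generated-isCongruence u v) (TotalIf-isCongruence (u ≡ v)) meet-is-identity
    where
      meet-is-identity : IsIdentityRel (λ x y → Generated u v x y × TotalIf (u ≡ v) x y)
      meet-is-identity x y (_ , inj₁ x≡y) = x≡y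
      meet-is-identity x y (p , inj₂ u≡v) = Generated-trivial u≡v p
  ... | inj₁ generated-id = yes (generated-id u v gen-base)
  ... | inj₂ totalIf-id   = no λ u≡v → nontrivial λ x y _ → totalIf-id x y (inj₂ u≡v)

module DeMorganMonoidTheory {ℓ : Level} (A : DMSignature ℓ) (M : IsDeMorganMonoid A) where
  open DMSignature A
  open IsDeMorganMonoid M

  -- The lattice reduct, as a library lattice; its natural order is x ≡ x ∧ y,
  -- the converse equation of our _≤_.
  lattice : Lattice ℓ ℓ
  lattice = record
    { Carrier = Carrier ; _≈_ = _≡_ ; _∨_ = _∨_ ; _∧_ = _∧_
    ; isLattice = record
      { isEquivalence = isEquivalence
      ; ∨-comm = ∨-comm ; ∨-assoc = ∨-assoc ; ∨-cong = cong₂ _∨_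
      ; ∧-comm = ∧-comm ; ∧-assoc = ∧-assoc ; ∧-cong = cong₂ _∧_
      ; absorptive = ∨-absorbs-∧ , ∧-absorbs-∨ } }

  private
    module Order = OrderTheoretic.Lattice (LatticeProperties.∨-∧-orderTheoreticLattice lattice)

  ≤-reflexive : ∀ {x y} → x ≡ y → x ≤ y
  ≤-reflexive x≡y = sym (Order.reflexive x≡y)

  ≤-trans : ∀ {x y z} → x ≤ y → y ≤ z → x ≤ z
  ≤-trans p q = sym (Order.trans (sym p) (sym q))

  ≤-antisym : ∀ {x y} → x ≤ y → y ≤ x → x ≡ y
  ≤-antisym p q = Order.antisym (sym p) (sym q)

  x∧y≤x : ∀ {x y} → x ∧ y ≤ x
  x∧y≤x {x} {y} = sym (Order.x∧y≤x x y)

  x∧y≤y : ∀ {x y} → x ∧ y ≤ y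
  x∧y≤y {x} {y} = sym (Order.x∧y≤y x y)

  ∧-greatest : ∀ {x y z} → z ≤ x → z ≤ y → z ≤ x ∧ y
  ∧-greatest p q = sym (Order.∧-greatest (sym p) (sym q))

  x≤x∨y : ∀ {x y} → x ≤ x ∨ y
  x≤x∨y {x} {y} = sym (Order.x≤x∨y x y)

  y≤x∨y : ∀ {x y} → y ≤ x ∨ y
  y≤x∨y {x} {y} = sym (Order.y≤x∨y x y)

  ∨-least : ∀ {x y z} → x ≤ z → y ≤ z → x ∨ y ≤ z
  ∨-least p q = sym (Order.∨-least (sym p) (sym q))

  poset : Poset ℓ ℓ ℓ
  poset = record
    { _≈_ = _≡_ ; _≤_ = _≤_
    ; isPartialOrder = record
      { isPreorder = record { isEquivalence = isEquivalence ; reflexive = ≤-reflexive ; trans = ≤-trans }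
      ; antisym = ≤-antisym } }

  open PartialOrderReasoning poset

  commutativeSemigroup : CommutativeSemigroup ℓ ℓ
  commutativeSemigroup = record
    { _≈_ = _≡_ ; _∙_ = _·_
    ; isCommutativeSemigroup = record
      { isSemigroup = record { isMagma = record { isEquivalence = isEquivalence ; ∙-cong = cong₂ _·_ }
                             ; assoc = ·-assoc }
      ; comm = ·-comm } }

  open CommutativeSemigroupProperties commutativeSemigroup using (interchange)

  ·-identityʳ : ∀ x → x · e ≡ x
  ·-identityʳ x = trans (·-comm x e) (·-identityˡ x)

  ∼f≡e : ∼ f ≡ e
  ∼f≡e = ∼-involutive e

  ∼f·y≡y : ∀ y → ∼ f · y ≡ y
  ∼f·y≡y y = trans (cong (_· y) ∼f≡e) (·-identityˡ y)

  ·≤f⇒≤∼ : ∀ {x y} → x · y ≤ f → y ≤ ∼ x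
  ·≤f⇒≤∼ {x} {y} p = subst (_≤ ∼ x) (∼f·y≡y y) (residuation⇒ x y f p)

  ≤∼⇒·≤f : ∀ {x y} → y ≤ ∼ x → x · y ≤ f
  ≤∼⇒·≤f {x} {y} p = residuation⇐ x y f (subst (_≤ ∼ x) (sym (∼f·y≡y y)) p)

  ∼-swap : ∀ {x y} → y ≤ ∼ x → x ≤ ∼ y
  ∼-swap {x} {y} p = ·≤f⇒≤∼ (subst (_≤ f) (·-comm x y) (≤∼⇒·≤f p))

  ∼-antitone : ∀ {x y} → x ≤ y → ∼ y ≤ ∼ x
  ∼-antitone {x} {y} p = ∼-swap (subst (x ≤_) (sym (∼-involutive y)) p)

  ∼-reflect : ∀ {x y} → ∼ x ≤ ∼ y → y ≤ x
  ∼-reflect {x} {y} p = subst (y ≤_) (∼-involutive x) (∼-swap p)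

  ∼x·x≤f : ∀ x → ∼ x · x ≤ f
  ∼x·x≤f x = ≤∼⇒·≤f (≤-reflexive (sym (∼-involutive x)))

  ∼∧∼≤∼∨ : ∀ {x y} → ∼ x ∧ ∼ y ≤ ∼ (x ∨ y)
  ∼∧∼≤∼∨ = ∼-swap (∨-least (∼-swap x∧y≤x) (∼-swap x∧y≤y))

  ∼∨≤∼∧∼ : ∀ {x y} → ∼ (x ∨ y) ≤ ∼ x ∧ ∼ y
  ∼∨≤∼∧∼ = ∧-greatest (∼-antitone x≤x∨y) (∼-antitone y≤x∨y)

  ·-monoˡ : ∀ {x y} z → x ≤ y → x · z ≤ y · z
  ·-monoˡ {x} {y} z p = residuation⇐ x z (y · z)
    (≤-trans (residuation⇒ y z (y · z) (≤-reflexive refl)) (∼-antitone p))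

  ·-monoʳ : ∀ {x y} z → x ≤ y → z · x ≤ z · y
  ·-monoʳ {x} {y} z p = subst₂ _≤_ (·-comm x z) (·-comm y z) (·-monoˡ z p)

  ·-mono : ∀ {x x′ y y′} → x ≤ x′ → y ≤ y′ → x · y ≤ x′ · y′
  ·-mono {x′ = x′} {y = y} p q = ≤-trans (·-monoˡ y p) (·-monoʳ x′ q)

  ·-distribʳ-∨ : ∀ x y z → (x ∨ y) · z ≤ x · z ∨ y · z
  ·-distribʳ-∨ x y z = residuation⇐ (x ∨ y) z w (≤-trans (∧-greatest ∼w·z≤∼x ∼w·z≤∼y) ∼∧∼≤∼∨)
    where
      w = x · z ∨ y · z
      ∼w·z≤∼x : ∼ w · z ≤ ∼ x
      ∼w·z≤∼x = residuation⇒ x z w x≤x∨y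
      ∼w·z≤∼y : ∼ w · z ≤ ∼ y
      ∼w·z≤∼y = residuation⇒ y z w y≤x∨y

  -- Negative elements are idempotent (x² ≤ e · x = x, and x ≤ x² always).
  below-e-idempotent : ∀ {x} → x ≤ e → x ² ≡ x
  below-e-idempotent {x} x≤e =
    ≤-antisym (≤-trans (·-monoˡ x x≤e) (≤-reflexive (·-identityˡ x))) (square-increasing x)

  x∧∼x≤f : ∀ x → x ∧ ∼ x ≤ f
  x∧∼x≤f x = begin
    x ∧ ∼ x               ≤⟨ square-increasing (x ∧ ∼ x) ⟩
    (x ∧ ∼ x) · (x ∧ ∼ x) ≤⟨ ·-mono x∧y≤y x∧y≤x ⟩
    ∼ x · x               ≤⟨ ∼x·x≤f x ⟩
    f                     ∎

  e≤x∨∼x : ∀ x → e ≤ x ∨ ∼ x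
  e≤x∨∼x x = ∼-reflect (begin
    ∼ (x ∨ ∼ x)   ≤⟨ ∼∨≤∼∧∼ ⟩
    ∼ x ∧ ∼ ∼ x   ≡⟨ cong (∼ x ∧_) (∼-involutive x) ⟩
    ∼ x ∧ x       ≡⟨ ∧-comm (∼ x) x ⟩
    x ∧ ∼ x       ≤⟨ x∧∼x≤f x ⟩
    ∼ e           ∎)

  above-f²-idempotent : ∀ {a} → f ² ≤ a → a ² ≡ a
  above-f²-idempotent {a} f²≤a = ≤-antisym a²≤a (square-increasing a)
    where
      b = ∼ a
      b≤∼f² : b ≤ ∼ (f ²)
      b≤∼f² = ∼-antitone f²≤a
      b²≡b : b ² ≡ b
      b²≡b = below-e-idempotent (≤-trans b≤∼f² (subst (∼ (f ²) ≤_) ∼f≡e (∼-antitone (square-increasing f))))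
      a²·b≤f : a ² · b ≤ f
      a²·b≤f = begin
        a ² · b               ≡⟨ cong (a ² ·_) (sym (trans (cong (_· b) b²≡b) b²≡b)) ⟩
        a ² · (b ² · b)       ≡⟨ sym (·-assoc (a ²) (b ²) b) ⟩
        a ² · b ² · b         ≡⟨ cong (_· b) (interchange a a b b) ⟩
        (a · b) ² · b         ≤⟨ ·-mono (·-mono (≤∼⇒·≤f (≤-reflexive refl)) (≤∼⇒·≤f (≤-reflexive refl))) b≤∼f² ⟩
        f ² · ∼ (f ²)         ≡⟨ ·-comm (f ²) (∼ (f ²)) ⟩
        ∼ (f ²) · f ²         ≤⟨ ∼x·x≤f (f ²) ⟩
        f                     ∎
      a²≤a : a ² ≤ a
      a²≤a = subst (a ² ≤_) (∼-involutive a) (∼-swap (·≤f⇒≤∼ a²·b≤f))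

  f²-idempotent : f ² ² ≡ f ²
  f²-idempotent = above-f²-idempotent (≤-reflexive refl)

  -- ∼(f²) absorbs a factor f from below, since f² · f = f².
  ∼f²·f≤∼f² : ∼ (f ²) · f ≤ ∼ (f ²)
  ∼f²·f≤∼f² = residuation⇒ (f ²) f (f ²)
    (≤-trans (·-monoʳ (f ²) (square-increasing f)) (≤-reflexive f²-idempotent))

  θ : Carrier → Rel Carrier ℓ
  θ d x y = x · d ≤ y × y · d ≤ x

  module NegativeCongruence {d : Carrier} (d≤e : d ≤ e) where
    d²≡d : d ² ≡ d
    d²≡d = below-e-idempotent d≤e

    x·d≤x : ∀ x → x · d ≤ x
    x·d≤x x = subst (x · d ≤_) (·-identityʳ x) (·-monoʳ x d≤e)

    step-trans : ∀ {x y z} → x · d ≤ y → y · d ≤ z → x · d ≤ z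
    step-trans {x} {y} {z} p q = begin
      x · d         ≡⟨ cong (x ·_) (sym d²≡d) ⟩
      x · (d · d)   ≡⟨ sym (·-assoc x d d) ⟩
      x · d · d     ≤⟨ ·-monoˡ d p ⟩
      y · d         ≤⟨ q ⟩
      z             ∎

    step-· : ∀ {x x′ y y′} → x · d ≤ x′ → y · d ≤ y′ → x · y · d ≤ x′ · y′
    step-· {x} {x′} {y} {y′} p q = begin
      x · y · d             ≡⟨ cong (x · y ·_) (sym d²≡d) ⟩
      (x · y) · (d · d)     ≡⟨ interchange x y d d ⟩
      (x · d) · (y · d)     ≤⟨ ·-mono p q ⟩
      x′ · y′               ∎

    step-∧ : ∀ {x x′ y y′} → x · d ≤ x′ → y · d ≤ y′ → (x ∧ y) · d ≤ x′ ∧ y′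
    step-∧ p q = ∧-greatest (≤-trans (·-monoˡ d x∧y≤x) p) (≤-trans (·-monoˡ d x∧y≤y) q)

    step-∨ : ∀ {x x′ y y′} → x · d ≤ x′ → y · d ≤ y′ → (x ∨ y) · d ≤ x′ ∨ y′
    step-∨ {x} {x′} {y} {y′} p q =
      ≤-trans (·-distribʳ-∨ x y d) (∨-least (≤-trans p x≤x∨y) (≤-trans q y≤x∨y))

    step-∼ : ∀ {x x′} → x · d ≤ x′ → ∼ x′ · d ≤ ∼ x
    step-∼ {x} {x′} p = residuation⇒ x d x′ p

    θ-isCongruence : IsCongruence A (θ d)
    θ-isCongruence = record
      { isEquivalence = record
        { refl  = λ {x} → x·d≤x x , x·d≤x x
        ; sym   = λ (p , q) → q , p
        ; trans = λ (p , q) (p′ , q′) → step-trans p p′ , step-trans q′ q }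
      ; ·-cong = λ (p , q) (p′ , q′) → step-· p p′ , step-· q q′
      ; ∧-cong = λ (p , q) (p′ , q′) → step-∧ p p′ , step-∧ q q′
      ; ∨-cong = λ (p , q) (p′ , q′) → step-∨ p p′ , step-∨ q q′
      ; ∼-cong = λ (p , q) → step-∼ q , step-∼ p }

    θ-identity⇒e≤d : IsIdentityRel (θ d) → e ≤ d
    θ-identity⇒e≤d θ-id =
      ≤-reflexive (θ-id e d (≤-reflexive (·-identityˡ d) , ≤-trans (≤-reflexive d²≡d) d≤e))

  FSI⇒e≤x⊎x≤f : FSI A → ∀ x → e ≤ x ⊎ x ≤ f
  FSI⇒e≤x⊎x≤f (_ , irreducible) x
    with irreducible (θ d₁) (θ d₂) (θ-isCongruence x∧y≤x) (θ-isCongruence x∧y≤x) meet-is-identity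
    where
      open NegativeCongruence
      d₁ = e ∧ x
      d₂ = e ∧ ∼ x
      d₁∨d₂≡e : d₁ ∨ d₂ ≡ e
      d₁∨d₂≡e = trans (sym (∧-distribˡ-∨ e x (∼ x))) (e≤x∨∼x x)
      both⇒≤ : ∀ {u v} → u · d₁ ≤ v → u · d₂ ≤ v → u ≤ v
      both⇒≤ {u} {v} p q = begin
        u                 ≡⟨ sym (·-identityʳ u) ⟩
        u · e             ≡⟨ cong (u ·_) (sym d₁∨d₂≡e) ⟩
        u · (d₁ ∨ d₂)     ≡⟨ ·-comm u (d₁ ∨ d₂) ⟩
        (d₁ ∨ d₂) · u     ≤⟨ ·-distribʳ-∨ d₁ d₂ u ⟩
        d₁ · u ∨ d₂ · u   ≡⟨ cong₂ _∨_ (·-comm d₁ u) (·-comm d₂ u) ⟩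
        u · d₁ ∨ u · d₂   ≤⟨ ∨-least p q ⟩
        v                 ∎
      meet-is-identity : IsIdentityRel (λ u v → θ d₁ u v × θ d₂ u v)
      meet-is-identity u v ((p₁ , q₁) , (p₂ , q₂)) = ≤-antisym (both⇒≤ p₁ p₂) (both⇒≤ q₁ q₂)
  ... | inj₁ θ₁-id = inj₁ (≤-trans (NegativeCongruence.θ-identity⇒e≤d x∧y≤x θ₁-id) x∧y≤y)
  ... | inj₂ θ₂-id = inj₂ (∼-swap (≤-trans (NegativeCongruence.θ-identity⇒e≤d x∧y≤x θ₂-id) x∧y≤y))

  FSI⇒idempotent⊎≤f² : FSI A → ∀ a → a ² ≡ a ⊎ a ≤ f ²
  FSI⇒idempotent⊎≤f² fsi a with FSI⇒e≤x⊎x≤f fsi (a · ∼ (f ²))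
  ... | inj₁ e≤a·g = inj₁ (above-f²-idempotent (∼-reflect (begin
    ∼ a                     ≡⟨ sym (·-identityˡ (∼ a)) ⟩
    e · ∼ a                 ≤⟨ ·-monoˡ (∼ a) e≤a·g ⟩
    a · ∼ (f ²) · ∼ a       ≡⟨ trans (·-comm _ (∼ a)) (sym (·-assoc (∼ a) a _)) ⟩
    ∼ a · a · ∼ (f ²)       ≤⟨ ·-monoˡ (∼ (f ²)) (∼x·x≤f a) ⟩
    f · ∼ (f ²)             ≡⟨ ·-comm f (∼ (f ²)) ⟩
    ∼ (f ²) · f             ≤⟨ ∼f²·f≤∼f² ⟩
    ∼ (f ²)                 ∎)))
  ... | inj₂ a·g≤f = inj₂ (subst (a ≤_) (∼-involutive (f ²)) (∼-swap (·≤f⇒≤∼ a·g≤f)))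

lemma5p14 : {ℓ : Level} (A : DMSignature ℓ) → IsDeMorganMonoid A → FSI A
    → (a : DMSignature.Carrier A)
    → DMSignature._≤_ A (DMSignature.f A) a
    → ¬ DMSignature._<_ A a (DMSignature._² A (DMSignature.f A))
    → DMSignature._·_ A a a ≡ a
lemma5p14 A M fsi a _ a≮f² = a²≡a
  where
    open DMSignature A
    open DeMorganMonoidTheory A M
    open FSI-DecidableEquality A using (FSI⇒≡-decidable)

    a²≡a : a ² ≡ a
    a²≡a with FSI⇒idempotent⊎≤f² fsi a
    ... | inj₁ idempotent = idempotent
    ... | inj₂ a≤f² with FSI⇒≡-decidable fsi a (f ²)
    ...   | yes a≡f² = subst (λ x → x ² ≡ x) (sym a≡f²) f²-idempotent
    ...   | no a≢f²  = ⊥-elim (a≮f² (a≤f² , a≢f²))
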